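{- For every integer $n\ge 4$, the complete graph $K_n$ satisfies $\mathrm{tcw}(K_n)=n$.
   Context: For a multigraph $G$ and $V'\subseteq V(G)$, $\delta_G(V')$ denotes the multiset of edges with exactly one endpoint in $V'$. A treecut decomposition of $G$ is a pair $(T,\chi)$ where $T$ is a rooted tree and $\chi:V(T)\to 2^{V(G)}$ is such that $\{\chi(t):t\in V(T)\}$ is a near partition of $V(G)$ (the sets $\chi(t)$ are pairwise disjoint, may be empty, and their union is $V(G)$). For $t\in V(T)$ let $T_t$ be the subtree rooted at $t$ and $V_t=\bigcup_{s\in V(T_t)}\chi(s)$. The adhesion of $t$ is $\mathrm{ad}(t)=\delta_G(V_t)$, and the torsowidth $\mathrm{tor}(t)$ is $|\chi(t)|$ plus the number of neighbours of $t$ in $T$. The width of $(T,\chi)$ is the maximum over $t\in V(T)$ of $\max\{|\mathrm{ad}(t)|,\mathrm{tor}(t)\}$, and $\mathrm{tcw}(G)$ is the minimum width of a treecut decomposition of $G$. (This is the treecut width for $3$-edge-connected graphs.) -}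

module Defs where

open import Data.Nat using (ℕ; zero; suc; _+_; _⊔_; _<ᵇ_)
open import Data.Bool using (Bool; true; false; _xor_; if_then_else_)
open import Data.Fin using (Fin; toℕ)
open import Data.Fin.Subset using (Subset; _∪_; ∣_∣) renaming (⊥ to ∅)
open import Data.Vec using (lookup)
open import Data.List using (List; []; _∷_; length; filterᵇ; concatMap; map; _++_; allFin)
open import Data.Product using (_×_; _,_; Σ)
open import Relation.Binary.PropositionalEquality using (_≡_)

-- A finite multigraph on vertex set Fin vcount; edges form a list (a multiset)
-- of unordered pairs, each written as an (endpoint, endpoint) pair.
record Multigraph : Set where
  field
    vcount : ℕ
    edges  : List (Fin vcount × Fin vcount)
open Multigraph public

K : ℕ → Multigraph
K n = record
  { vcount = n
  ; edges  = concatMap (λ i → map (λ j → (i , j))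
                                   (filterᵇ (λ j → toℕ i <ᵇ toℕ j) (allFin n)))
                       (allFin n)
  }

crossing : ∀ {n} → Subset n → Fin n × Fin n → Bool
crossing S (u , v) = lookup S u xor lookup S v

cutSize : (G : Multigraph) → Subset (vcount G) → ℕ
cutSize G S = length (filterᵇ (crossing S) (edges G))

data RTree (n : ℕ) : Set where
  node : Subset n → List (RTree n) → RTree n

mutual
  subtreeVerts : ∀ {n} → RTree n → Subset n
  subtreeVerts (node S cs) = S ∪ forestVerts cs

  forestVerts : ∀ {n} → List (RTree n) → Subset n
  forestVerts []       = ∅
  forestVerts (c ∷ cs) = subtreeVerts c ∪ forestVerts cs

mutual
  bags : ∀ {n} → RTree n → List (Subset n)
  bags (node S cs) = S ∷ forestBags cs

  forestBags : ∀ {n} → List (RTree n) → List (Subset n)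
  forestBags []       = []
  forestBags (c ∷ cs) = bags c ++ forestBags cs

IsNearPartition : ∀ {n} → RTree n → Set
IsNearPartition {n} T = ∀ (v : Fin n) → length (filterᵇ (λ S → lookup S v) (bags T)) ≡ 1

TreecutDecomposition : Multigraph → Set
TreecutDecomposition G = Σ (RTree (vcount G)) IsNearPartition

-- width: maximum over nodes t of max(|ad(t)|, tor(t)), where
-- tor(t) = |χ(t)| + (#children) + (1 if t is not the root).
mutual
  nodeWidth : (G : Multigraph) → Bool → RTree (vcount G) → ℕ
  nodeWidth G isRoot (node S cs) =
    (cutSize G (subtreeVerts (node S cs))
      ⊔ (∣ S ∣ + length cs + (if isRoot then 0 else 1)))
    ⊔ forestWidth G cs

  forestWidth : (G : Multigraph) → List (RTree (vcount G)) → ℕ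
  forestWidth G []       = 0
  forestWidth G (c ∷ cs) = nodeWidth G false c ⊔ forestWidth G cs

width : (G : Multigraph) → TreecutDecomposition G → ℕ
width G (T , _) = nodeWidth G true T

TcwIs : Multigraph → ℕ → Set
TcwIs G k = Σ (TreecutDecomposition G) (λ d → width G d ≡ k)
          × (∀ (d : TreecutDecomposition G) → k Data.Nat.≤ width G d)

-- The one-bag decomposition has width n. Conversely, a vertex set S of K n is crossed by
-- ∣ S ∣ * ∣ ∁ S ∣ ≥ ∣ S ∣ + ∣ ∁ S ∣ = n edges once both sides have two vertices. Descend from
-- the root along nodes t whose V_t misses at most one vertex, and none at the root; the edge
-- to the parent makes up for a missing vertex in tor(t). A child with two or more vertices
-- either is such a node again or has adhesion ≥ n; if no child qualifies, every child subtree
-- holds at most one vertex, so ∣ V_t ∣ ≤ ∣ χ(t) ∣ + #children and tor(t) ≥ n.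
module Submission where

open import Defs
open import Data.Nat using (ℕ; _≤_; suc; _+_; _*_; _⊔_; _<ᵇ_; z≤n; s≤s; _≤?_)
open import Data.Nat.Properties
open import Data.Bool using (Bool; true; false; not; _∧_; _∨_; if_then_else_)
open import Data.Bool.Properties using (∨-assoc)
open import Data.Fin using (Fin; toℕ) renaming (zero to fzero; suc to fsuc)
open import Data.Fin.Subset using (Subset; inside; outside; _∪_; ∁; ∣_∣; ⊤) renaming (⊥ to ∅)
open import Data.Fin.Subset.Properties using (∣p∣≤n; ∣⊥∣≡0; ∣⊤∣≡n; ∣∁p∣≡n∸∣p∣; ∪-zeroˡ)
open import Data.Vec using (lookup; _∷_; [])
open import Data.Vec.Properties using (lookup-map; lookup-zipWith; lookup-replicate)
open import Data.List using (List; []; _∷_; length; filterᵇ; map; concatMap; tabulate; _++_)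
open import Data.List.Properties using (length-++; filter-++)
open import Data.Bool.ListAction using (any)
open import Data.Product using (_×_; _,_)
open import Data.Sum using (_⊎_; inj₁; inj₂)
open import Function using (_∘_; id)
open import Relation.Nullary using (yes; no)
open import Relation.Nullary.Decidable using (T?)
open import Relation.Binary.PropositionalEquality
open import Algebra.Properties.Monoid.Sum +-0-monoid using (sum-syntax; sum-cong-≗)

private variable
  A B : Set
  n : ℕ

iverson : Bool → ℕ
iverson b = if b then 1 else 0

countᵇ : (A → Bool) → List A → ℕ
countᵇ P xs = length (filterᵇ P xs)

countᵇ-++ : ∀ (P : A → Bool) xs ys → countᵇ P (xs ++ ys) ≡ countᵇ P xs + countᵇ P ys
countᵇ-++ P xs ys = trans (cong length (filter-++ (T? ∘ P) xs ys)) (length-++ (filterᵇ P xs))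

countᵇ-map : ∀ (P : B → Bool) (f : A → B) xs → countᵇ P (map f xs) ≡ countᵇ (P ∘ f) xs
countᵇ-map P f [] = refl
countᵇ-map P f (x ∷ xs) with P (f x)
... | true  = cong suc (countᵇ-map P f xs)
... | false = countᵇ-map P f xs

countᵇ-filterᵇ : ∀ (P Q : A → Bool) xs → countᵇ P (filterᵇ Q xs) ≡ countᵇ (λ x → Q x ∧ P x) xs
countᵇ-filterᵇ P Q [] = refl
countᵇ-filterᵇ P Q (x ∷ xs) with Q x
... | false = countᵇ-filterᵇ P Q xs
... | true with P x
...   | true  = cong suc (countᵇ-filterᵇ P Q xs)
...   | false = countᵇ-filterᵇ P Q xs

countᵇ-tabulate : ∀ (P : A → Bool) (h : Fin n → A) → countᵇ P (tabulate h) ≡ ∑[ i < n ] iverson (P (h i))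
countᵇ-tabulate {n = 0}     P h = refl
countᵇ-tabulate {n = suc n} P h with P (h fzero)
... | true  = cong suc (countᵇ-tabulate P (h ∘ fsuc))
... | false = countᵇ-tabulate P (h ∘ fsuc)

countᵇ-concatMap-tabulate : ∀ (P : B → Bool) (F : A → List B) (h : Fin n → A) →
  countᵇ P (concatMap F (tabulate h)) ≡ ∑[ i < n ] countᵇ P (F (h i))
countᵇ-concatMap-tabulate {n = 0}     P F h = refl
countᵇ-concatMap-tabulate {n = suc n} P F h =
  trans (countᵇ-++ P (F (h fzero)) _) (cong (countᵇ P (F (h fzero)) +_) (countᵇ-concatMap-tabulate P F (h ∘ fsuc)))

∑-iverson-lookup : ∀ (p : Subset n) → ∑[ j < n ] iverson (lookup p j) ≡ ∣ p ∣
∑-iverson-lookup []            = refl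
∑-iverson-lookup (outside ∷ p) = ∑-iverson-lookup p
∑-iverson-lookup (inside ∷ p)  = cong suc (∑-iverson-lookup p)

∑-iverson-lookup-∁ : ∀ (p : Subset n) → ∑[ j < n ] iverson (not (lookup p j)) ≡ ∣ ∁ p ∣
∑-iverson-lookup-∁ p =
  trans (sum-cong-≗ (λ j → cong iverson (sym (lookup-map j not p)))) (∑-iverson-lookup (∁ p))

crossesForward : Subset n → Fin n → Fin n → Bool
crossesForward p i j = (toℕ i <ᵇ toℕ j) ∧ crossing p (i , j)

crossingPairs : Subset n → ℕ
crossingPairs {n} p = ∑[ i < n ] ∑[ j < n ] iverson (crossesForward p i j)

cutSize-K≡crossingPairs : ∀ (p : Subset n) → cutSize (K n) p ≡ crossingPairs p
cutSize-K≡crossingPairs {n} p =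
  trans (countᵇ-concatMap-tabulate (crossing p) row id) (sum-cong-≗ row-count)
  where
  later : Fin n → List (Fin n)
  later i = filterᵇ (λ j → toℕ i <ᵇ toℕ j) (tabulate id)

  row : Fin n → List (Fin n × Fin n)
  row i = map (i ,_) (later i)

  row-count : ∀ i → countᵇ (crossing p) (row i) ≡ ∑[ j < n ] iverson (crossesForward p i j)
  row-count i = begin
    countᵇ (crossing p) (row i)                     ≡⟨ countᵇ-map (crossing p) (i ,_) (later i) ⟩
    countᵇ (λ j → crossing p (i , j)) (later i)      ≡⟨ countᵇ-filterᵇ (crossing p ∘ (i ,_)) (λ j → toℕ i <ᵇ toℕ j) (tabulate id) ⟩
    countᵇ (crossesForward p i) (tabulate id)       ≡⟨ countᵇ-tabulate (crossesForward p i) id ⟩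
    ∑[ j < n ] iverson (crossesForward p i j)       ∎
    where open ≡-Reasoning

-- crossingPairs (b ∷ p) unfolds to ∑[ j < n ] iverson (b xor lookup p j) + crossingPairs p.
crossingPairs≡∣p∣*∣∁p∣ : ∀ (p : Subset n) → crossingPairs p ≡ ∣ p ∣ * ∣ ∁ p ∣
crossingPairs≡∣p∣*∣∁p∣ []            = refl
crossingPairs≡∣p∣*∣∁p∣ (inside ∷ p)  =
  cong₂ _+_ (∑-iverson-lookup-∁ p) (crossingPairs≡∣p∣*∣∁p∣ p)
crossingPairs≡∣p∣*∣∁p∣ (outside ∷ p) =
  trans (cong₂ _+_ (∑-iverson-lookup p) (crossingPairs≡∣p∣*∣∁p∣ p)) (sym (*-suc ∣ p ∣ ∣ ∁ p ∣))

cutSize-K : ∀ (p : Subset n) → cutSize (K n) p ≡ ∣ p ∣ * ∣ ∁ p ∣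
cutSize-K p = trans (cutSize-K≡crossingPairs p) (crossingPairs≡∣p∣*∣∁p∣ p)

m+n≤m*n : ∀ m n → 2 ≤ m → 2 ≤ n → m + n ≤ m * n
m+n≤m*n m (suc (suc k)) 2≤m _ = begin
  m + suc (suc k)   ≤⟨ +-monoʳ-≤ m 2+k≤m*[1+k] ⟩
  m + m * suc k     ≡⟨ *-suc m (suc k) ⟨
  m * suc (suc k)   ∎
  where
  open ≤-Reasoning
  2+k≤m*[1+k] : suc (suc k) ≤ m * suc k
  2+k≤m*[1+k] = begin
    suc (suc k)       ≤⟨ s≤s (m≤n+m (suc k) k) ⟩
    suc (k + suc k)   ≡⟨ cong (suc k +_) (+-identityʳ (suc k)) ⟨
    2 * suc k         ≤⟨ *-monoˡ-≤ (suc k) 2≤m ⟩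
    m * suc k         ∎
m+n≤m*n m 1 _ (s≤s ())

∣p∪q∣≤∣p∣+∣q∣ : ∀ (p q : Subset n) → ∣ p ∪ q ∣ ≤ ∣ p ∣ + ∣ q ∣
∣p∪q∣≤∣p∣+∣q∣ []            []            = z≤n
∣p∪q∣≤∣p∣+∣q∣ (outside ∷ p) (outside ∷ q) = ∣p∪q∣≤∣p∣+∣q∣ p q
∣p∪q∣≤∣p∣+∣q∣ (outside ∷ p) (inside ∷ q)  =
  ≤-trans (s≤s (∣p∪q∣≤∣p∣+∣q∣ p q)) (≤-reflexive (sym (+-suc ∣ p ∣ ∣ q ∣)))
∣p∪q∣≤∣p∣+∣q∣ (inside ∷ p)  (outside ∷ q) = s≤s (∣p∪q∣≤∣p∣+∣q∣ p q)
∣p∪q∣≤∣p∣+∣q∣ (inside ∷ p)  (inside ∷ q)  =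
  s≤s (≤-trans (∣p∪q∣≤∣p∣+∣q∣ p q) (≤-trans (n≤1+n _) (≤-reflexive (sym (+-suc ∣ p ∣ ∣ q ∣)))))

∣p∣+∣∁p∣≡n : ∀ (p : Subset n) → ∣ p ∣ + ∣ ∁ p ∣ ≡ n
∣p∣+∣∁p∣≡n p = trans (cong (∣ p ∣ +_) (∣∁p∣≡n∸∣p∣ p)) (m+[n∸m]≡n (∣p∣≤n p))

LargeBalancedCuts : Multigraph → Set
LargeBalancedCuts G = ∀ (S : Subset (vcount G)) → 2 ≤ ∣ S ∣ → 2 ≤ ∣ ∁ S ∣ → vcount G ≤ cutSize G S

K-largeBalancedCuts : ∀ n → LargeBalancedCuts (K n)
K-largeBalancedCuts n S 2≤∣S∣ 2≤∣∁S∣ = begin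
  n                ≡⟨ ∣p∣+∣∁p∣≡n S ⟨
  ∣ S ∣ + ∣ ∁ S ∣  ≤⟨ m+n≤m*n ∣ S ∣ ∣ ∁ S ∣ 2≤∣S∣ 2≤∣∁S∣ ⟩
  ∣ S ∣ * ∣ ∁ S ∣  ≡⟨ cutSize-K S ⟨
  cutSize (K n) S  ∎
  where open ≤-Reasoning

any-++ : ∀ (P : A → Bool) xs ys → any P (xs ++ ys) ≡ any P xs ∨ any P ys
any-++ P []       ys = refl
any-++ P (x ∷ xs) ys = trans (cong (P x ∨_) (any-++ P xs ys)) (sym (∨-assoc (P x) (any P xs) (any P ys)))

any≡false⇒countᵇ≡0 : ∀ (P : A → Bool) xs → any P xs ≡ false → countᵇ P xs ≡ 0
any≡false⇒countᵇ≡0 P []       _ = refl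
any≡false⇒countᵇ≡0 P (x ∷ xs) h with P x
... | false = any≡false⇒countᵇ≡0 P xs h

mutual
  lookup-subtreeVerts : ∀ (t : RTree n) v → lookup (subtreeVerts t) v ≡ any (λ S → lookup S v) (bags t)
  lookup-subtreeVerts (node S cs) v =
    trans (lookup-zipWith _∨_ v S (forestVerts cs)) (cong (lookup S v ∨_) (lookup-forestVerts cs v))

  lookup-forestVerts : ∀ (cs : List (RTree n)) v → lookup (forestVerts cs) v ≡ any (λ S → lookup S v) (forestBags cs)
  lookup-forestVerts []       v = lookup-replicate v false
  lookup-forestVerts (c ∷ cs) v = begin
    lookup (subtreeVerts c ∪ forestVerts cs) v
      ≡⟨ lookup-zipWith _∨_ v (subtreeVerts c) (forestVerts cs) ⟩
    lookup (subtreeVerts c) v ∨ lookup (forestVerts cs) v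
      ≡⟨ cong₂ _∨_ (lookup-subtreeVerts c v) (lookup-forestVerts cs v) ⟩
    any (λ S → lookup S v) (bags c) ∨ any (λ S → lookup S v) (forestBags cs)
      ≡⟨ any-++ (λ S → lookup S v) (bags c) (forestBags cs) ⟨
    any (λ S → lookup S v) (bags c ++ forestBags cs) ∎
    where open ≡-Reasoning

lookup≡true⇒∣p∣≡n : ∀ (p : Subset n) → (∀ v → lookup p v ≡ true) → ∣ p ∣ ≡ n
lookup≡true⇒∣p∣≡n []            _ = refl
lookup≡true⇒∣p∣≡n (inside ∷ p)  h = cong suc (lookup≡true⇒∣p∣≡n p (h ∘ fsuc))
lookup≡true⇒∣p∣≡n (outside ∷ p) h with () ← h fzero

∣subtreeVerts∣≡n : ∀ (t : RTree n) → IsNearPartition t → ∣ subtreeVerts t ∣ ≡ n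
∣subtreeVerts∣≡n t np = lookup≡true⇒∣p∣≡n (subtreeVerts t) covered
  where
  covered : ∀ v → lookup (subtreeVerts t) v ≡ true
  covered v with lookup (subtreeVerts t) v in eq
  ... | true  = refl
  ... | false with () ← trans (sym (np v))
                          (any≡false⇒countᵇ≡0 (λ S → lookup S v) (bags t) (trans (sym (lookup-subtreeVerts t v)) eq))

cutSize-⊤ : ∀ G → cutSize G ⊤ ≡ 0
cutSize-⊤ G = noneCrossing (edges G)
  where
  noneCrossing : ∀ es → countᵇ (crossing ⊤) es ≡ 0
  noneCrossing [] = refl
  noneCrossing ((u , v) ∷ es) rewrite lookup-replicate u true | lookup-replicate v true = noneCrossing es

trivialDecomposition : ∀ G → TreecutDecomposition G
trivialDecomposition G = node ⊤ [] , single
  where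
  single : IsNearPartition (node ⊤ [])
  single v rewrite lookup-replicate v true = refl

width-trivialDecomposition : ∀ G → width G (trivialDecomposition G) ≡ vcount G
width-trivialDecomposition G = begin
  (cutSize G (⊤ ∪ ∅) ⊔ (∣ ⊤ {vcount G} ∣ + 0 + 0)) ⊔ 0  ≡⟨ ⊔-identityʳ _ ⟩
  cutSize G (⊤ ∪ ∅) ⊔ (∣ ⊤ {vcount G} ∣ + 0 + 0)        ≡⟨ cong₂ _⊔_ noAdhesion torso ⟩
  0 ⊔ vcount G                                          ∎
  where
  open ≡-Reasoning
  noAdhesion : cutSize G (⊤ ∪ ∅) ≡ 0
  noAdhesion = trans (cong (cutSize G) (∪-zeroˡ ∅)) (cutSize-⊤ G)
  torso : ∣ ⊤ {vcount G} ∣ + 0 + 0 ≡ vcount G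
  torso = trans (+-identityʳ _) (trans (+-identityʳ _) (∣⊤∣≡n _))

module _ (G : Multigraph) where

  adhesion≤nodeWidth : ∀ isRoot t → cutSize G (subtreeVerts t) ≤ nodeWidth G isRoot t
  adhesion≤nodeWidth isRoot (node S cs) = ≤-trans (m≤m⊔n _ _) (m≤m⊔n _ _)

  torso≤nodeWidth : ∀ isRoot S cs → ∣ S ∣ + length cs + (if isRoot then 0 else 1) ≤ nodeWidth G isRoot (node S cs)
  torso≤nodeWidth isRoot S cs = ≤-trans (m≤n⊔m (cutSize G (subtreeVerts (node S cs))) _) (m≤m⊔n _ _)

  forestWidth≤nodeWidth : ∀ isRoot S cs → forestWidth G cs ≤ nodeWidth G isRoot (node S cs)
  forestWidth≤nodeWidth isRoot S cs = m≤n⊔m _ _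

module _ (G : Multigraph) (largeCuts : LargeBalancedCuts G) where

  mutual
    vcount≤nodeWidth : ∀ isRoot t → vcount G ≤ ∣ subtreeVerts t ∣ + (if isRoot then 0 else 1) → vcount G ≤ nodeWidth G isRoot t
    vcount≤nodeWidth isRoot (node S cs) h with vcount≤forestWidth⊎thin cs
    ... | inj₁ wide = ≤-trans wide (forestWidth≤nodeWidth G isRoot S cs)
    ... | inj₂ thin = ≤-trans torso (torso≤nodeWidth G isRoot S cs)
      where
      open ≤-Reasoning
      torso : vcount G ≤ ∣ S ∣ + length cs + (if isRoot then 0 else 1)
      torso = begin
        vcount G                                                ≤⟨ h ⟩
        ∣ S ∪ forestVerts cs ∣ + (if isRoot then 0 else 1)           ≤⟨ +-monoˡ-≤ _ (∣p∪q∣≤∣p∣+∣q∣ S (forestVerts cs)) ⟩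
        ∣ S ∣ + ∣ forestVerts cs ∣ + (if isRoot then 0 else 1)       ≤⟨ +-monoˡ-≤ _ (+-monoʳ-≤ ∣ S ∣ thin) ⟩
        ∣ S ∣ + length cs + (if isRoot then 0 else 1)                ∎

    vcount≤forestWidth⊎thin : ∀ cs → vcount G ≤ forestWidth G cs ⊎ ∣ forestVerts cs ∣ ≤ length cs
    vcount≤forestWidth⊎thin [] = inj₂ (≤-reflexive (∣⊥∣≡0 (vcount G)))
    vcount≤forestWidth⊎thin (c ∷ cs) with vcount≤childWidth⊎small c | vcount≤forestWidth⊎thin cs
    ... | inj₁ wide  | _         = inj₁ (≤-trans wide (m≤m⊔n _ _))
    ... | inj₂ _     | inj₁ wide = inj₁ (≤-trans wide (m≤n⊔m _ _))
    ... | inj₂ small | inj₂ thin =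
      inj₂ (≤-trans (∣p∪q∣≤∣p∣+∣q∣ (subtreeVerts c) (forestVerts cs)) (+-mono-≤ small thin))

    vcount≤childWidth⊎small : ∀ c → vcount G ≤ nodeWidth G false c ⊎ ∣ subtreeVerts c ∣ ≤ 1
    vcount≤childWidth⊎small c with ∣ subtreeVerts c ∣ ≤? 1 | ∣ ∁ (subtreeVerts c) ∣ ≤? 1
    ... | yes small | _           = inj₂ small
    ... | no big    | yes coSmall = inj₁ (vcount≤nodeWidth false c (begin
      vcount G                                      ≡⟨ ∣p∣+∣∁p∣≡n (subtreeVerts c) ⟨
      ∣ subtreeVerts c ∣ + ∣ ∁ (subtreeVerts c) ∣   ≤⟨ +-monoʳ-≤ ∣ subtreeVerts c ∣ coSmall ⟩
      ∣ subtreeVerts c ∣ + 1                        ∎))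
      where open ≤-Reasoning
    ... | no big    | no coBig    =
      inj₁ (≤-trans (largeCuts (subtreeVerts c) (≰⇒> big) (≰⇒> coBig)) (adhesion≤nodeWidth G false c))

  vcount≤width : ∀ d → vcount G ≤ width G d
  vcount≤width (t , np) = vcount≤nodeWidth true t (≤-reflexive (sym (trans (+-identityʳ _) (∣subtreeVerts∣≡n t np))))

-- The equality holds for every n; the paper assumes n ≥ 4 only so that K n is 3-edge-connected.
mainTheorem2 : ∀ (n : ℕ) → 4 ≤ n → TcwIs (K n) n
mainTheorem2 n _ =
  (trivialDecomposition (K n) , width-trivialDecomposition (K n)) ,
  vcount≤width (K n) (K-largeBalancedCuts n)
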